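{- Let $\beta\in\mathbb{Q}$ with $\beta>1$ be a fixed constant, and let $p_1,\dots,p_{n-1}$ be positive integers. Let $S_n$ be the star with centre $0$ and leaves $1,\dots,n-1$, and define the distribution $\pi_0=\frac{\beta-1}{\beta}$ and $\pi_j=\frac1\beta\cdot\frac{p_j}{\sum_k p_k}$ for $j\in\{1,\dots,n-1\}$. Then $\lambda_\infty(S_n,\pi)=\beta$ if and only if the multiset $\{p_1,\dots,p_{n-1}\}$ can be partitioned into two subsets of equal sum; otherwise $\lambda_\infty(S_n,\pi)\ge\beta+\Omega\!\left(\frac{\beta-1}{\beta(\sum_k p_k)^2}\right)$.
   Context: $\lambda_\infty(G,\pi)=\inf_{f:V\to\mathbb{R},\,\mathrm{Var}_\pi(f)>0}\mathbb{E}_{v\sim\pi}[\max_{u\in N(v)}|f(v)-f(u)|^2]/\mathrm{Var}_\pi(f)$, where $N(v)$ is the neighbourhood of $v$ and $\mathrm{Var}_\pi$ is the variance under $\pi$. The $\Omega$ hides a positive constant (with $\beta$ fixed).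
   Formalization: The test functions f in the infimum defining λ_∞ take rational values instead of real ones. -}

module Defs where

open import Data.Nat as ℕ using (ℕ; zero; suc)
import Data.Nat.Properties as ℕP
open import Data.Fin using (Fin; zero; suc)
open import Data.List using (List; []; _∷_; map; foldr; allFin)
open import Data.Bool using (Bool; true; false; if_then_else_)
open import Data.Integer using (+_)
open import Data.Rational
open import Data.Rational.Properties using (positive⁻¹; <-trans)
open import Data.Product using (Σ; ∃; _×_; _,_)
open import Function using (_∘_)

sumℚ : ∀ {n} → (Fin n → ℚ) → ℚ
sumℚ {zero}  f = 0ℚ
sumℚ {suc n} f = f zero + sumℚ (f ∘ suc)

sumℕ : ∀ {n} → (Fin n → ℕ) → ℕ
sumℕ {zero}  f = 0
sumℕ {suc n} f = f zero ℕ.+ sumℕ (f ∘ suc)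

-- maximum of a list of (nonnegative) rationals; empty maximum is 0
maxList : List ℚ → ℚ
maxList = foldr _⊔_ 0ℚ

sq : ℚ → ℚ
sq x = x * x

Graph : ℕ → Set
Graph n = Fin n → List (Fin n)

Energy∞ : ∀ {n} → Graph n → (Fin n → ℚ) → (Fin n → ℚ) → ℚ
Energy∞ G π f = sumℚ (λ v → π v * maxList (map (λ u → sq (f v - f u)) (G v)))

Mean : ∀ {n} → (Fin n → ℚ) → (Fin n → ℚ) → ℚ
Mean π f = sumℚ (λ v → π v * f v)

Var : ∀ {n} → (Fin n → ℚ) → (Fin n → ℚ) → ℚ
Var π f = sumℚ (λ v → π v * sq (f v - Mean π f))

Ratio∞ : ∀ {n} (G : Graph n) (π f : Fin n → ℚ) → 0ℚ < Var π f → ℚ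
Ratio∞ G π f h = (Energy∞ G π f ÷ Var π f) {{>-nonZero h}}

-- "λ_∞(G,π) = λ": λ is the infimum of Ratio∞ over all f with Var_π(f) > 0
IsLambdaInf : ∀ {n} → Graph n → (Fin n → ℚ) → ℚ → Set
IsLambdaInf {n} G π λ₀ =
  ((f : Fin n → ℚ) (h : 0ℚ < Var π f) → λ₀ ≤ Ratio∞ G π f h)
  × ((ε : ℚ) → 0ℚ < ε →
       Σ (Fin n → ℚ) λ f → Σ (0ℚ < Var π f) λ h → Ratio∞ G π f h < λ₀ + ε)

LambdaInf≥ : ∀ {n} → Graph n → (Fin n → ℚ) → ℚ → Set
LambdaInf≥ {n} G π c = (f : Fin n → ℚ) (h : 0ℚ < Var π f) → c ≤ Ratio∞ G π f h

-- The star S_n (n = k+2 vertices): centre 0, leaves suc j for j : Fin (suc k)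

Star : (k : ℕ) → Graph (suc (suc k))
Star k zero    = map suc (allFin (suc k))
Star k (suc j) = zero ∷ []

ℕtoℚ : ℕ → ℚ
ℕtoℚ m = + m / 1

0<1ℚ : 0ℚ < 1ℚ
0<1ℚ = positive⁻¹ 1ℚ

inv : (q : ℚ) → 0ℚ < q → ℚ
inv q h = (1/ q) {{>-nonZero h}}

sum-pos : ∀ {k} (p : Fin (suc k) → ℕ) → (∀ j → 0 ℕ.< p j) → 0 ℕ.< sumℕ p
sum-pos p pos = ℕP.≤-trans (pos zero) (ℕP.m≤m+n (p zero) _)

starπ : ∀ k (β : ℚ) → 1ℚ < β → (p : Fin (suc k) → ℕ) → (∀ j → 0 ℕ.< p j)
      → Fin (suc (suc k)) → ℚ
starπ k β hβ p pos zero    = (β - 1ℚ) * inv β (<-trans 0<1ℚ hβ)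
starπ k β hβ p pos (suc j) =
  inv β (<-trans 0<1ℚ hβ) * (+ p j / sumℕ p) {{ℕ.>-nonZero (sum-pos p pos)}}

subsetSum : ∀ {m} → (Fin m → Bool) → (Fin m → ℕ) → ℕ
subsetSum A p = sumℕ (λ j → if A j then p j else 0)

complementSum : ∀ {m} → (Fin m → Bool) → (Fin m → ℕ) → ℕ
complementSum A p = sumℕ (λ j → if A j then 0 else p j)

EqualPartition : ∀ {m} → (Fin m → ℕ) → Set
EqualPartition {m} p = ∃ λ (A : Fin m → Bool) → subsetSum A p ≡ complementSum A p
  where open import Relation.Binary.PropositionalEquality using (_≡_)

omegaScale : ∀ k (β : ℚ) → 1ℚ < β → (p : Fin (suc k) → ℕ) → (∀ j → 0 ℕ.< p j) → ℚ
omegaScale k β hβ p pos =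
  (β - 1ℚ) * inv β (<-trans 0<1ℚ hβ) * (+ 1 / (sumℕ p ℕ.* sumℕ p))
    {{ℕP.m*n≢0 (sumℕ p) (sumℕ p) {{S≢0}} {{S≢0}}}}
  where S≢0 = ℕ.>-nonZero (sum-pos p pos)

{-# OPTIONS --safe #-}
module Submission where

-- Write d_j = f(j) − f(0) for the leaves j, w = 1/β = Σ_j π_j, a = Σ_j π_j d_j², b = Σ_j π_j d_j
-- and M = max_j d_j². Then Var_π f = a − b² and the energy is π_0 M + a with π_0 = (β − 1) w, so
--   Energy − β Var = (β − 1)(w M − a) + β b² ≥ 0.
-- An equal-sum partition gives f = ±1 on its two parts (0 at the centre), for which this excess
-- vanishes. Otherwise put m = max_j |d_j|, s_j = sign d_j and R = Σ_j π_j (m − |d_j|). Then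
-- w M − a ≥ m R and |w m Σ_j ρ_j s_j − b| ≤ R with ρ_j = p_j / S, while Σ_j ρ_j s_j is a nonzero
-- multiple of 1/S because the signs split the leaves unevenly. Hence X = w m / S ≤ |b| + R, so
-- |b| or R is at least X/2, and either way the excess is at least (β − 1) X²/4, which in turn is
-- at least (β − 1)/(4 β S²) · Var.

open import Defs
open import Data.Nat using (ℕ; suc) renaming (_<_ to _<ℕ_)
open import Data.Fin using (Fin)
open import Data.Rational
open import Data.Product using (Σ; _×_)
open import Relation.Nullary using (¬_)
open import Function.Bundles using (_⇔_)

open import Data.Bool using (Bool; true; false; if_then_else_)
open import Data.Empty using (⊥-elim)
open import Data.Fin using (zero; suc)
open import Data.Fin.Subset.Properties using (anySubset?)
open import Data.Integer as ℤ using (+_)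
import Data.Integer.Properties as ℤₚ
import Data.Integer.Tactic.RingSolver as ℤ-Solver
open import Data.List using ([]; _∷_; map)
open import Data.List.Membership.Propositional using (_∈_)
open import Data.List.Membership.Propositional.Properties using (∈-map⁺; ∈-map⁻; ∈-allFin)
open import Data.List.Relation.Unary.All using (All; _∷_; universal)
import Data.List.Relation.Unary.All.Properties as All
open import Data.List.Relation.Unary.Any using (here; there)
import Data.Nat as ℕ
import Data.Nat.Properties as ℕₚ
open import Data.Product using (∃-syntax; _,_; proj₁; proj₂)
open import Data.Rational.Properties
open import Data.Rational.Solver using (module +-*-Solver)
open import Data.Rational.Unnormalised as ℚᵘ using (mkℚᵘ; *≡*)
import Data.Rational.Unnormalised.Properties as ℚᵘₚ
open import Data.Sum using (inj₁; inj₂)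
open import Data.Vec using (lookup; tabulate)
open import Data.Vec.Properties using (lookup∘tabulate)
open import Function using (_∘_)
open import Function.Bundles using (mk⇔)
open import Relation.Binary.Definitions using (tri<; tri≈; tri>)
open import Relation.Binary.PropositionalEquality
open import Relation.Nullary using (Dec; yes; no; does)
open import Relation.Nullary.Decidable using (decidable-stable)

open +-*-Solver using (solve; _:=_; con; _:+_; _:-_; :-_; _:*_)

private variable
  p q r : ℚ

≤-from-gap : 0ℚ ≤ r → q ≡ p + r → p ≤ q
≤-from-gap {r} {p = p} 0≤r refl = subst (_≤ p + r) (+-identityʳ p) (+-monoʳ-≤ p 0≤r)

p≤q⇒0≤q-p : p ≤ q → 0ℚ ≤ q - p
p≤q⇒0≤q-p {p} {q} p≤q = subst (_≤ q - p) (+-inverseʳ p) (+-monoˡ-≤ (- p) p≤q)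

p<q⇒0<q-p : p < q → 0ℚ < q - p
p<q⇒0<q-p {p} {q} p<q = subst (_< q - p) (+-inverseʳ p) (+-monoˡ-< (- p) p<q)

+-nonNeg : 0ℚ ≤ p → 0ℚ ≤ q → 0ℚ ≤ p + q
+-nonNeg 0≤p 0≤q = +-mono-≤ 0≤p 0≤q

*-nonNeg : 0ℚ ≤ p → 0ℚ ≤ q → 0ℚ ≤ p * q
*-nonNeg {p} {q} 0≤p 0≤q =
  nonNegative⁻¹ _ {{nonNeg*nonNeg⇒nonNeg p {{nonNegative 0≤p}} q {{nonNegative 0≤q}}}}

*-pos : 0ℚ < p → 0ℚ < q → 0ℚ < p * q
*-pos {p} {q} 0<p 0<q = positive⁻¹ _ {{pos*pos⇒pos p {{positive 0<p}} q {{positive 0<q}}}}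

p≤∣p∣ : ∀ p → p ≤ ∣ p ∣
p≤∣p∣ p with 0ℚ ≤? p
... | yes 0≤p = ≤-reflexive (sym (0≤p⇒∣p∣≡p 0≤p))
... | no  0≰p = ≤-trans (<⇒≤ (≰⇒> 0≰p)) (0≤∣p∣ p)

∣p-q∣≡∣q-p∣ : ∀ p q → ∣ p - q ∣ ≡ ∣ q - p ∣
∣p-q∣≡∣q-p∣ p q = trans (cong ∣_∣ (negate-diff p q)) (∣-p∣≡∣p∣ (q - p))
  where
  negate-diff : ∀ p q → p - q ≡ - (q - p)
  negate-diff = solve 2 (λ p q → p :- q := :- (q :- p)) refl

sq-∣∣ : ∀ p → sq ∣ p ∣ ≡ sq p
sq-∣∣ p with ∣p∣≡p∨∣p∣≡-p p
... | inj₁ ∣p∣≡p  = cong sq ∣p∣≡p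
... | inj₂ ∣p∣≡-p = trans (cong sq ∣p∣≡-p) (sq-neg p)
  where
  sq-neg : ∀ p → - p * - p ≡ p * p
  sq-neg = solve 1 (λ p → :- p :* :- p := p :* p) refl

sq-nonNeg : ∀ p → 0ℚ ≤ sq p
sq-nonNeg p = subst (0ℚ ≤_) (sq-∣∣ p) (*-nonNeg (0≤∣p∣ p) (0≤∣p∣ p))

sq-mono-< : 0ℚ ≤ p → p < q → sq p < sq q
sq-mono-< {p} {q} 0≤p p<q =
  ≤-<-trans (*-monoˡ-≤-nonNeg p {{nonNegative 0≤p}} (<⇒≤ p<q))
            (*-monoˡ-<-pos q {{positive (≤-<-trans 0≤p p<q)}} p<q)

sq-cancel-≤ : sq p ≤ sq q → ∣ p ∣ ≤ ∣ q ∣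
sq-cancel-≤ {p} {q} p²≤q² with ∣ p ∣ ≤? ∣ q ∣
... | yes ∣p∣≤∣q∣ = ∣p∣≤∣q∣
... | no  ∣p∣≰∣q∣ = ⊥-elim (<-irrefl refl (<-≤-trans q²<p² p²≤q²))
  where
  q²<p² : sq q < sq p
  q²<p² = subst₂ _<_ (sq-∣∣ q) (sq-∣∣ p) (sq-mono-< (0≤∣p∣ q) (≰⇒> ∣p∣≰∣q∣))

*÷-cancel : (0<r : 0ℚ < r) → (p * r ÷ r) {{>-nonZero 0<r}} ≡ p
*÷-cancel {r} {p} 0<r =
  trans (*-assoc p r _) (trans (cong (p *_) (*-inverseʳ r {{>-nonZero 0<r}})) (*-identityʳ p))

*≤⇒≤÷ : (0<r : 0ℚ < r) → p * r ≤ q → p ≤ (q ÷ r) {{>-nonZero 0<r}}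
*≤⇒≤÷ {r} {p} {q} 0<r pr≤q =
  subst (_≤ q * r⁻¹) (*÷-cancel 0<r) (*-monoʳ-≤-nonNeg r⁻¹ {{0≤r⁻¹}} pr≤q)
  where
  r⁻¹ : ℚ
  r⁻¹ = (1/ r) {{>-nonZero 0<r}}
  0≤r⁻¹ : NonNegative r⁻¹
  0≤r⁻¹ = pos⇒nonNeg r⁻¹ {{1/pos⇒pos r {{positive 0<r}}}}

0≤1 : 0ℚ ≤ 1ℚ
0≤1 = <⇒≤ 0<1ℚ

¼-nonNeg : 0ℚ ≤ + 1 / 4
¼-nonNeg = nonNegative⁻¹ _

4-nonNeg : 0ℚ ≤ + 4 / 1
4-nonNeg = nonNegative⁻¹ _

sumℚ-cong : ∀ {n} {f g : Fin n → ℚ} → (∀ i → f i ≡ g i) → sumℚ f ≡ sumℚ g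
sumℚ-cong {ℕ.zero} f≗g = refl
sumℚ-cong {suc n}  f≗g = cong₂ _+_ (f≗g zero) (sumℚ-cong (f≗g ∘ suc))

sumℚ-+ : ∀ {n} (f g : Fin n → ℚ) → sumℚ (λ i → f i + g i) ≡ sumℚ f + sumℚ g
sumℚ-+ {ℕ.zero} f g = refl
sumℚ-+ {suc n}  f g = trans (cong (_+_ (f zero + g zero)) (sumℚ-+ (f ∘ suc) (g ∘ suc)))
                            (interchange (f zero) (g zero) _ _)
  where
  interchange : ∀ a b c d → (a + b) + (c + d) ≡ (a + c) + (b + d)
  interchange = solve 4 (λ a b c d → (a :+ b) :+ (c :+ d) := (a :+ c) :+ (b :+ d)) refl

sumℚ-- : ∀ {n} (f g : Fin n → ℚ) → sumℚ (λ i → f i - g i) ≡ sumℚ f - sumℚ g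
sumℚ-- {ℕ.zero} f g = refl
sumℚ-- {suc n}  f g = trans (cong (_+_ (f zero - g zero)) (sumℚ-- (f ∘ suc) (g ∘ suc)))
                            (interchange (f zero) (g zero) _ _)
  where
  interchange : ∀ a b c d → (a - b) + (c - d) ≡ (a + c) - (b + d)
  interchange = solve 4 (λ a b c d → (a :- b) :+ (c :- d) := (a :+ c) :- (b :+ d)) refl

sumℚ-* : ∀ {n} c (f : Fin n → ℚ) → sumℚ (λ i → c * f i) ≡ c * sumℚ f
sumℚ-* {ℕ.zero} c f = sym (*-zeroʳ c)
sumℚ-* {suc n}  c f = trans (cong (_+_ (c * f zero)) (sumℚ-* c (f ∘ suc)))
                            (sym (*-distribˡ-+ c (f zero) _))

sumℚ-mono-≤ : ∀ {n} {f g : Fin n → ℚ} → (∀ i → f i ≤ g i) → sumℚ f ≤ sumℚ g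
sumℚ-mono-≤ {ℕ.zero} f≤g = ≤-refl
sumℚ-mono-≤ {suc n}  f≤g = +-mono-≤ (f≤g zero) (sumℚ-mono-≤ (f≤g ∘ suc))

sumℚ-nonNeg : ∀ {n} {f : Fin n → ℚ} → (∀ i → 0ℚ ≤ f i) → 0ℚ ≤ sumℚ f
sumℚ-nonNeg {ℕ.zero} 0≤f = ≤-refl
sumℚ-nonNeg {suc n}  0≤f = +-nonNeg (0≤f zero) (sumℚ-nonNeg (0≤f ∘ suc))

∣sumℚ∣≤sumℚ∣∣ : ∀ {n} (f : Fin n → ℚ) → ∣ sumℚ f ∣ ≤ sumℚ (λ i → ∣ f i ∣)
∣sumℚ∣≤sumℚ∣∣ {ℕ.zero} f = ≤-refl
∣sumℚ∣≤sumℚ∣∣ {suc n}  f =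
  ≤-trans (∣p+q∣≤∣p∣+∣q∣ (f zero) _) (+-monoʳ-≤ ∣ f zero ∣ (∣sumℚ∣≤sumℚ∣∣ (f ∘ suc)))

≤-maxList : ∀ {x xs} → x ∈ xs → x ≤ maxList xs
≤-maxList {xs = y ∷ ys} (here refl)  = p≤p⊔q y (maxList ys)
≤-maxList {xs = y ∷ ys} (there x∈ys) = p≤q⇒p≤r⊔q y (≤-maxList x∈ys)

maxList-∈ : ∀ {x xs} → All (0ℚ ≤_) (x ∷ xs) → maxList (x ∷ xs) ∈ x ∷ xs
maxList-∈ {x} {[]}     (0≤x ∷ _) = here (p≥q⇒p⊔q≡p 0≤x)
maxList-∈ {x} {y ∷ ys} (_ ∷ 0≤ys) with ⊔-sel x (maxList (y ∷ ys))
... | inj₁ max≡x = here max≡x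
... | inj₂ max≡m = there (subst (_∈ y ∷ ys) (sym max≡m) (maxList-∈ 0≤ys))

module _ {n} (π f : Fin n → ℚ) (Σπ≡1 : sumℚ π ≡ 1ℚ) where

  Mean-shift : ∀ c → sumℚ (λ v → π v * (f v - c)) ≡ Mean π f - c
  Mean-shift c = begin
    sumℚ (λ v → π v * (f v - c))       ≡⟨ sumℚ-cong (λ v → expand (π v) (f v) c) ⟩
    sumℚ (λ v → π v * f v - c * π v)   ≡⟨ sumℚ-- (λ v → π v * f v) (λ v → c * π v) ⟩
    Mean π f - sumℚ (λ v → c * π v)    ≡⟨ cong (_-_ (Mean π f)) (trans (sumℚ-* c π) (cong (c *_) Σπ≡1)) ⟩
    Mean π f - c * 1ℚ                  ≡⟨ cong (_-_ (Mean π f)) (*-identityʳ c) ⟩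
    Mean π f - c                       ∎
    where
    open ≡-Reasoning
    expand : ∀ p x c → p * (x - c) ≡ p * x - c * p
    expand = solve 3 (λ p x c → p :* (x :- c) := p :* x :- c :* p) refl

  Var-shift : ∀ c → Var π f ≡ sumℚ (λ v → π v * sq (f v - c)) - sq (Mean π f - c)
  Var-shift c = begin
    Var π f
      ≡⟨ sumℚ-cong (λ v → expand (π v) (f v) c (Mean π f)) ⟩
    sumℚ (λ v → (P v - (e + e) * Q v) + e * e * π v)
      ≡⟨ sumℚ-+ (λ v → P v - (e + e) * Q v) (λ v → e * e * π v) ⟩
    sumℚ (λ v → P v - (e + e) * Q v) + sumℚ (λ v → e * e * π v)
      ≡⟨ cong₂ _+_ (sumℚ-- P (λ v → (e + e) * Q v)) (sumℚ-* (e * e) π) ⟩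
    (sumℚ P - sumℚ (λ v → (e + e) * Q v)) + e * e * sumℚ π
      ≡⟨ cong₂ (λ x y → (sumℚ P - x) + e * e * y)
               (trans (sumℚ-* (e + e) Q) (cong ((e + e) *_) (Mean-shift c))) Σπ≡1 ⟩
    (sumℚ P - (e + e) * e) + e * e * 1ℚ
      ≡⟨ collect (sumℚ P) e ⟩
    sumℚ P - sq e ∎
    where
    open ≡-Reasoning
    e : ℚ
    e = Mean π f - c
    P Q : Fin n → ℚ
    P v = π v * sq (f v - c)
    Q v = π v * (f v - c)
    expand : ∀ p x c μ → p * ((x - μ) * (x - μ))
           ≡ (p * ((x - c) * (x - c)) - ((μ - c) + (μ - c)) * (p * (x - c))) + (μ - c) * (μ - c) * p
    expand = solve 4 (λ p x c μ → p :* ((x :- μ) :* (x :- μ))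
                                 := (p :* ((x :- c) :* (x :- c)) :- ((μ :- c) :+ (μ :- c)) :* (p :* (x :- c)))
                                    :+ (μ :- c) :* (μ :- c) :* p)
                      refl
    collect : ∀ s e → (s - (e + e) * e) + e * e * 1ℚ ≡ s - e * e
    collect = solve 2 (λ s e → (s :- (e :+ e) :* e) :+ e :* e :* con 1ℚ := s :- e :* e) refl

a/n+b/n≡[a+b]/n : ∀ a b n .{{_ : ℕ.NonZero n}} → + a / n + + b / n ≡ + (a ℕ.+ b) / n
a/n+b/n≡[a+b]/n a b n@(suc m) = toℚᵘ-injective (begin
  toℚᵘ (+ a / n + + b / n)              ≈⟨ toℚᵘ-homo-+ (+ a / n) (+ b / n) ⟩
  toℚᵘ (+ a / n) ℚᵘ.+ toℚᵘ (+ b / n)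
    ≈⟨ ℚᵘₚ.+-cong (toℚᵘ-fromℚᵘ (mkℚᵘ (+ a) m)) (toℚᵘ-fromℚᵘ (mkℚᵘ (+ b) m)) ⟩
  mkℚᵘ (+ a) m ℚᵘ.+ mkℚᵘ (+ b) m        ≈⟨ *≡* (identity (+ a) (+ b) (+ n)) ⟩
  mkℚᵘ (+ (a ℕ.+ b)) m                  ≈⟨ toℚᵘ-fromℚᵘ (mkℚᵘ (+ (a ℕ.+ b)) m) ⟨
  toℚᵘ (+ (a ℕ.+ b) / n)                ∎)
  where
  open ℚᵘₚ.≃-Reasoning
  identity : ∀ x y n → (x ℤ.* n ℤ.+ y ℤ.* n) ℤ.* n ≡ (x ℤ.+ y) ℤ.* (n ℤ.* n)
  identity = ℤ-Solver.solve-∀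

n/n≡1 : ∀ n .{{_ : ℕ.NonZero n}} → + n / n ≡ 1ℚ
n/n≡1 n@(suc m) =
  toℚᵘ-injective (ℚᵘₚ.≃-trans (toℚᵘ-fromℚᵘ (mkℚᵘ (+ n) m)) (*≡* (ℤₚ.*-comm (+ n) (+ 1))))

1/[m*n]≡1/m*1/n : ∀ m n .{{_ : ℕ.NonZero m}} .{{_ : ℕ.NonZero n}} →
                  (+ 1 / (m ℕ.* n)) {{ℕₚ.m*n≢0 m n}} ≡ (+ 1 / m) * (+ 1 / n)
1/[m*n]≡1/m*1/n (suc m) (suc n) = toℚᵘ-injective (begin
  toℚᵘ (+ 1 / (suc m ℕ.* suc n))             ≈⟨ toℚᵘ-fromℚᵘ (mkℚᵘ (+ 1) (n ℕ.+ m ℕ.* suc n)) ⟩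
  mkℚᵘ (+ 1) (n ℕ.+ m ℕ.* suc n)             ≈⟨ *≡* refl ⟩
  mkℚᵘ (+ 1) m ℚᵘ.* mkℚᵘ (+ 1) n
    ≈⟨ ℚᵘₚ.*-cong (toℚᵘ-fromℚᵘ (mkℚᵘ (+ 1) m)) (toℚᵘ-fromℚᵘ (mkℚᵘ (+ 1) n)) ⟨
  toℚᵘ (+ 1 / suc m) ℚᵘ.* toℚᵘ (+ 1 / suc n) ≈⟨ toℚᵘ-homo-* (+ 1 / suc m) (+ 1 / suc n) ⟨
  toℚᵘ ((+ 1 / suc m) * (+ 1 / suc n))       ∎)
  where open ℚᵘₚ.≃-Reasoning

/-monoˡ-≤ : ∀ {a b} n .{{_ : ℕ.NonZero n}} → a ℕ.≤ b → + a / n ≤ + b / n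
/-monoˡ-≤ {a} n a≤b with ℕₚ.m≤n⇒∃[o]m+o≡n a≤b
... | o , refl = ≤-from-gap (nonNegative⁻¹ _ {{normalize-nonNeg o n}}) (sym (a/n+b/n≡[a+b]/n a o n))

a<b⇒1/n≤b/n-a/n : ∀ {a b} n .{{_ : ℕ.NonZero n}} → a ℕ.< b → + 1 / n ≤ + b / n - + a / n
a<b⇒1/n≤b/n-a/n {a} {b} n a<b =
  ≤-from-gap (p≤q⇒0≤q-p (subst (_≤ + b / n) (sym (a/n+b/n≡[a+b]/n 1 a n)) (/-monoˡ-≤ n a<b)))
             (regroup (+ b / n) (+ a / n) (+ 1 / n))
  where
  regroup : ∀ y x u → y - x ≡ u + (y - (u + x))
  regroup = solve 3 (λ y x u → y :- x := u :+ (y :- (u :+ x))) refl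

1/n≤∣a/n-b/n∣ : ∀ {a b} n .{{_ : ℕ.NonZero n}} → a ≢ b → + 1 / n ≤ ∣ + a / n - + b / n ∣
1/n≤∣a/n-b/n∣ {a} {b} n a≢b with ℕₚ.<-cmp a b
... | tri< a<b _ _ = ≤-trans (a<b⇒1/n≤b/n-a/n n a<b)
                             (≤-trans (p≤∣p∣ _) (≤-reflexive (∣p-q∣≡∣q-p∣ (+ b / n) (+ a / n))))
... | tri≈ _ a≡b _ = ⊥-elim (a≢b a≡b)
... | tri> _ _ b<a = ≤-trans (a<b⇒1/n≤b/n-a/n n b<a) (p≤∣p∣ _)

sumℚ-/ : ∀ {k} n .{{_ : ℕ.NonZero n}} (g : Fin k → ℕ) → sumℚ (λ j → + g j / n) ≡ + sumℕ g / n
sumℚ-/ {ℕ.zero} n g = sym (0/n≡0 n)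
sumℚ-/ {suc k}  n g = trans (cong (_+_ (+ g zero / n)) (sumℚ-/ n (g ∘ suc)))
                            (a/n+b/n≡[a+b]/n (g zero) (sumℕ (g ∘ suc)) n)

sign : Bool → ℚ
sign true  = 1ℚ
sign false = - 1ℚ

sumℚ-signed : ∀ {k} n .{{_ : ℕ.NonZero n}} (A : Fin k → Bool) (g : Fin k → ℕ) →
              sumℚ (λ j → (+ g j / n) * sign (A j)) ≡ + subsetSum A g / n - + complementSum A g / n
sumℚ-signed {k} n A g =
  trans (sumℚ-cong (λ j → split (A j) (g j)))
        (trans (sumℚ-- In Out)
               (cong₂ _-_ (sumℚ-/ n (λ j → if A j then g j else 0))
                          (sumℚ-/ n (λ j → if A j then 0 else g j))))
  where
  In Out : Fin k → ℚ
  In  j = + (if A j then g j else 0) / n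
  Out j = + (if A j then 0 else g j) / n
  x*1≡x-0 : ∀ x → x * 1ℚ ≡ x - 0ℚ
  x*1≡x-0 = solve 1 (λ x → x :* con 1ℚ := x :- con 0ℚ) refl
  x*-1≡0-x : ∀ x → x * - 1ℚ ≡ 0ℚ - x
  x*-1≡0-x = solve 1 (λ x → x :* :- con 1ℚ := con 0ℚ :- x) refl
  split : ∀ b x → (+ x / n) * sign b ≡ + (if b then x else 0) / n - + (if b then 0 else x) / n
  split true  x = trans (x*1≡x-0 (+ x / n)) (cong (_-_ (+ x / n)) (sym (0/n≡0 n)))
  split false x = trans (x*-1≡0-x (+ x / n)) (cong (_- + x / n) (sym (0/n≡0 n)))

sumℕ-cong : ∀ {k} {f g : Fin k → ℕ} → (∀ i → f i ≡ g i) → sumℕ f ≡ sumℕ g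
sumℕ-cong {ℕ.zero} f≗g = refl
sumℕ-cong {suc k}  f≗g = cong₂ ℕ._+_ (f≗g zero) (sumℕ-cong (f≗g ∘ suc))

balanced-cong : ∀ {k} {A B : Fin k → Bool} (g : Fin k → ℕ) → (∀ j → A j ≡ B j) →
                subsetSum A g ≡ complementSum A g → subsetSum B g ≡ complementSum B g
balanced-cong g A≗B balanced =
  trans (sumℕ-cong (λ j → cong (λ b → if b then g j else 0) (sym (A≗B j))))
        (trans balanced (sumℕ-cong (λ j → cong (λ b → if b then 0 else g j) (A≗B j))))

equalPartition? : ∀ {k} (p : Fin k → ℕ) → Dec (EqualPartition p)
equalPartition? p with anySubset? (λ A → subsetSum (lookup A) p ℕ.≟ complementSum (lookup A) p)
... | yes (A , balanced) = yes (lookup A , balanced)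
... | no  unbalanced     = no λ (A , balanced) →
        unbalanced (tabulate A , balanced-cong p (λ j → sym (lookup∘tabulate A j)) balanced)

sign-∣∣ : ∀ {x} (0≤x? : Dec (0ℚ ≤ x)) → sign (does 0≤x?) * ∣ x ∣ ≡ x
sign-∣∣ {x} (yes 0≤x) = trans (*-identityˡ ∣ x ∣) (0≤p⇒∣p∣≡p 0≤x)
sign-∣∣ {x} (no  0≰x) with ∣p∣≡p∨∣p∣≡-p x
... | inj₁ ∣x∣≡x  = ⊥-elim (0≰x (∣p∣≡p⇒0≤p ∣x∣≡x))
... | inj₂ ∣x∣≡-x = trans (cong (- 1ℚ *_) ∣x∣≡-x) (neg-neg x)
  where
  neg-neg : ∀ x → - 1ℚ * - x ≡ x
  neg-neg = solve 1 (λ x → :- con 1ℚ :* :- x := x) refl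

∣m*s-s*y∣≡m-y : ∀ b {m y} → y ≤ m → ∣ m * sign b - sign b * y ∣ ≡ m - y
∣m*s-s*y∣≡m-y true  {m} {y} y≤m = trans (cong ∣_∣ (plus m y)) (0≤p⇒∣p∣≡p (p≤q⇒0≤q-p y≤m))
  where
  plus : ∀ m y → m * 1ℚ - 1ℚ * y ≡ m - y
  plus = solve 2 (λ m y → m :* con 1ℚ :- con 1ℚ :* y := m :- y) refl
∣m*s-s*y∣≡m-y false {m} {y} y≤m =
  trans (cong ∣_∣ (minus m y)) (trans (∣-p∣≡∣p∣ (m - y)) (0≤p⇒∣p∣≡p (p≤q⇒0≤q-p y≤m)))
  where
  minus : ∀ m y → m * - 1ℚ - - 1ℚ * y ≡ - (m - y)
  minus = solve 2 (λ m y → m :* :- con 1ℚ :- :- con 1ℚ :* y := :- (m :- y)) refl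

m*[m-y]≤m²-y² : 0ℚ ≤ q → q ≤ p → p * (p - q) ≤ sq p - sq q
m*[m-y]≤m²-y² {q} {p} 0≤q q≤p = ≤-from-gap (*-nonNeg 0≤q (p≤q⇒0≤q-p q≤p)) (identity p q)
  where
  identity : ∀ p q → p * p - q * q ≡ p * (p - q) + q * (p - q)
  identity = solve 2 (λ p q → p :* p :- q :* q := p :* (p :- q) :+ q :* (p :- q)) refl

-- If R ≤ y then X ≤ 2y, so X² ≤ 4y²; otherwise X ≤ 2R, so X² ≤ mX ≤ 2mR ≤ 2D.
quarter-bound : ∀ {β D X m R y} → 1ℚ ≤ β → 0ℚ ≤ X → X ≤ m → 0ℚ ≤ D → m * R ≤ D → X ≤ y + R →
                + 1 / 4 * ((β - 1ℚ) * sq X) ≤ (β - 1ℚ) * D + β * sq y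
quarter-bound {β} {D} {X} {m} {R} {y} 1≤β 0≤X X≤m 0≤D mR≤D X≤y+R with R ≤? y
... | yes R≤y = ≤-from-gap (*-nonNeg ¼-nonNeg certificate) (identity β D X y R)
  where
  G : ℚ
  G = (y - R) + ((y + R) - X)
  0≤G : 0ℚ ≤ G
  0≤G = +-nonNeg (p≤q⇒0≤q-p R≤y) (p≤q⇒0≤q-p X≤y+R)
  certificate : 0ℚ ≤ + 4 / 1 * ((β - 1ℚ) * D) + β * (G * G + (G + G) * X) + X * X
  certificate = +-nonNeg (+-nonNeg (*-nonNeg 4-nonNeg (*-nonNeg (p≤q⇒0≤q-p 1≤β) 0≤D))
                                   (*-nonNeg (≤-trans 0≤1 1≤β)
                                             (+-nonNeg (*-nonNeg 0≤G 0≤G) (*-nonNeg (+-nonNeg 0≤G 0≤G) 0≤X))))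
                         (*-nonNeg 0≤X 0≤X)
  identity : ∀ β D X y R → let G = (y - R) + ((y + R) - X) in
             (β - 1ℚ) * D + β * (y * y)
             ≡ + 1 / 4 * ((β - 1ℚ) * (X * X))
               + + 1 / 4 * (+ 4 / 1 * ((β - 1ℚ) * D) + β * (G * G + (G + G) * X) + X * X)
  identity = solve 5 (λ β D X y R → let G = (y :- R) :+ ((y :+ R) :- X) in
               (β :- con 1ℚ) :* D :+ β :* (y :* y)
               := con (+ 1 / 4) :* ((β :- con 1ℚ) :* (X :* X))
                  :+ con (+ 1 / 4) :* (con (+ 4 / 1) :* ((β :- con 1ℚ) :* D) :+ β :* (G :* G :+ (G :+ G) :* X) :+ X :* X))
             refl
... | no  R≰y = ≤-from-gap (*-nonNeg ¼-nonNeg certificate) (identity β D X m y R)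
  where
  G : ℚ
  G = (R - y) + ((y + R) - X)
  0≤G : 0ℚ ≤ G
  0≤G = +-nonNeg (p≤q⇒0≤q-p (<⇒≤ (≰⇒> R≰y))) (p≤q⇒0≤q-p X≤y+R)
  0≤m : 0ℚ ≤ m
  0≤m = ≤-trans 0≤X X≤m
  certificate : 0ℚ ≤ (β - 1ℚ) * (+ 4 / 1 * (D - m * R) + (m + m) * G + X * (m - X) + X * m)
                     + + 4 / 1 * β * (y * y)
  certificate = +-nonNeg (*-nonNeg (p≤q⇒0≤q-p 1≤β)
                           (+-nonNeg (+-nonNeg (+-nonNeg (*-nonNeg 4-nonNeg (p≤q⇒0≤q-p mR≤D))
                                                         (*-nonNeg (+-nonNeg 0≤m 0≤m) 0≤G))
                                               (*-nonNeg 0≤X (p≤q⇒0≤q-p X≤m)))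
                                     (*-nonNeg 0≤X 0≤m)))
                         (*-nonNeg (*-nonNeg 4-nonNeg (≤-trans 0≤1 1≤β)) (sq-nonNeg y))
  identity : ∀ β D X m y R → let G = (R - y) + ((y + R) - X) in
             (β - 1ℚ) * D + β * (y * y)
             ≡ + 1 / 4 * ((β - 1ℚ) * (X * X))
               + + 1 / 4 * ((β - 1ℚ) * (+ 4 / 1 * (D - m * R) + (m + m) * G + X * (m - X) + X * m)
                            + + 4 / 1 * β * (y * y))
  identity = solve 6 (λ β D X m y R → let G = (R :- y) :+ ((y :+ R) :- X) in
               (β :- con 1ℚ) :* D :+ β :* (y :* y)
               := con (+ 1 / 4) :* ((β :- con 1ℚ) :* (X :* X))
                  :+ con (+ 1 / 4) :* ((β :- con 1ℚ) :* (con (+ 4 / 1) :* (D :- m :* R) :+ (m :+ m) :* G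
                                                        :+ X :* (m :- X) :+ X :* m)
                                       :+ con (+ 4 / 1) :* β :* (y :* y)))
             refl

module StarGraph (β : ℚ) (1<β : 1ℚ < β) (k : ℕ) (p : Fin (suc k) → ℕ) (pos : ∀ j → 0 <ℕ p j) where

  π : Fin (suc (suc k)) → ℚ
  π = starπ k β 1<β p pos

  0<β : 0ℚ < β
  0<β = <-trans 0<1ℚ 1<β

  1≤β : 1ℚ ≤ β
  1≤β = <⇒≤ 1<β

  w : ℚ
  w = inv β 0<β

  S : ℕ
  S = sumℕ p

  instance
    S≢0 : ℕ.NonZero S
    S≢0 = ℕ.>-nonZero (sum-pos p pos)

  ρ : Fin (suc k) → ℚ
  ρ j = + p j / S

  u : ℚ
  u = + 1 / S

  0<w : 0ℚ < w
  0<w = positive⁻¹ w {{1/pos⇒pos β {{positive 0<β}}}}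

  0≤w : 0ℚ ≤ w
  0≤w = <⇒≤ 0<w

  w≤1 : w ≤ 1ℚ
  w≤1 = subst₂ _≤_ (*-identityˡ w) (*-inverseʳ β {{>-nonZero 0<β}})
               (*-monoʳ-≤-nonNeg w {{nonNegative 0≤w}} 1≤β)

  0<u : 0ℚ < u
  0<u = positive⁻¹ u {{normalize-pos 1 S}}

  u≤1 : u ≤ 1ℚ
  u≤1 = subst (u ≤_) (n/n≡1 S) (/-monoˡ-≤ S (sum-pos p pos))

  0≤π-leaf : ∀ j → 0ℚ ≤ π (suc j)
  0≤π-leaf j = *-nonNeg 0≤w (nonNegative⁻¹ _ {{normalize-nonNeg (p j) S}})

  Σπ-leaf≡w : sumℚ (π ∘ suc) ≡ w
  Σπ-leaf≡w = trans (sumℚ-* w ρ) (trans (cong (w *_) (trans (sumℚ-/ S p) (n/n≡1 S))) (*-identityʳ w))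

  Σπ≡1 : sumℚ π ≡ 1ℚ
  Σπ≡1 = trans (cong (_+_ (π zero)) Σπ-leaf≡w)
               (trans (collect β w) (*-inverseʳ β {{>-nonZero 0<β}}))
    where
    collect : ∀ β w → (β - 1ℚ) * w + w ≡ β * w
    collect = solve 2 (λ β w → (β :- con 1ℚ) :* w :+ w := β :* w) refl

  omegaScale≡ : omegaScale k β 1<β p pos ≡ (β - 1ℚ) * w * sq u
  omegaScale≡ = cong (_*_ ((β - 1ℚ) * w)) (1/[m*n]≡1/m*1/n S S)

  module TestFunction (f : Fin (suc (suc k)) → ℚ) where

    d : Fin (suc k) → ℚ
    d j = f (suc j) - f zero

    a b M D excess : ℚ
    a = sumℚ (λ j → π (suc j) * sq (d j))
    b = sumℚ (λ j → π (suc j) * d j)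
    M = maxList (map (λ v → sq (f zero - f v)) (Star k zero))
    D = w * M - a
    excess = (β - 1ℚ) * D + β * sq b

    Var≡a-b² : Var π f ≡ a - sq b
    Var≡a-b² = trans (Var-shift π f Σπ≡1 (f zero))
                     (cong₂ (λ s e → s - sq e) (centre-vanishes (π zero) (f zero) a)
                            (trans (sym (Mean-shift π f Σπ≡1 (f zero))) (centre-vanishes′ (π zero) (f zero) b)))
      where
      centre-vanishes : ∀ c x a → c * ((x - x) * (x - x)) + a ≡ a
      centre-vanishes = solve 3 (λ c x a → c :* ((x :- x) :* (x :- x)) :+ a := a) refl
      centre-vanishes′ : ∀ c x b → c * (x - x) + b ≡ b
      centre-vanishes′ = solve 3 (λ c x b → c :* (x :- x) :+ b := b) refl

    Energy≡ : Energy∞ (Star k) π f ≡ π zero * M + a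
    Energy≡ = cong (_+_ (π zero * M))
                   (sumℚ-cong (λ j → cong (π (suc j) *_) (p≥q⇒p⊔q≡p (sq-nonNeg (d j)))))

    sq-swap : ∀ x y → (x - y) * (x - y) ≡ (y - x) * (y - x)
    sq-swap = solve 2 (λ x y → (x :- y) :* (x :- y) := (y :- x) :* (y :- x)) refl

    sq-d≤M : ∀ j → sq (d j) ≤ M
    sq-d≤M j = subst (_≤ M) (sq-swap (f zero) (f (suc j)))
                     (≤-maxList (∈-map⁺ (λ v → sq (f zero - f v)) (∈-map⁺ suc (∈-allFin j))))

    M-attained : ∃[ j ] M ≡ sq (d j)
    M-attained with ∈-map⁻ (λ v → sq (f zero - f v))
                            (maxList-∈ (All.map⁺ (universal (λ v → sq-nonNeg (f zero - f v)) (Star k zero))))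
    ... | v , v∈leaves , M≡ with ∈-map⁻ suc v∈leaves
    ... | j , _ , refl = j , trans M≡ (sq-swap (f zero) (f (suc j)))

    D≡Σ : D ≡ sumℚ (λ j → π (suc j) * (M - sq (d j)))
    D≡Σ = sym (begin
      sumℚ (λ j → π (suc j) * (M - sq (d j)))
        ≡⟨ sumℚ-cong (λ j → distribute (π (suc j)) M (sq (d j))) ⟩
      sumℚ (λ j → M * π (suc j) - π (suc j) * sq (d j))
        ≡⟨ sumℚ-- (λ j → M * π (suc j)) (λ j → π (suc j) * sq (d j)) ⟩
      sumℚ (λ j → M * π (suc j)) - a
        ≡⟨ cong (_- a) (trans (sumℚ-* M (π ∘ suc)) (trans (cong (M *_) Σπ-leaf≡w) (*-comm M w))) ⟩
      D ∎)
      where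
      open ≡-Reasoning
      distribute : ∀ c M s → c * (M - s) ≡ M * c - c * s
      distribute = solve 3 (λ c M s → c :* (M :- s) := M :* c :- c :* s) refl

    0≤D : 0ℚ ≤ D
    0≤D = subst (0ℚ ≤_) (sym D≡Σ) (sumℚ-nonNeg (λ j → *-nonNeg (0≤π-leaf j) (p≤q⇒0≤q-p (sq-d≤M j))))

    0≤excess : 0ℚ ≤ excess
    0≤excess = +-nonNeg (*-nonNeg (p≤q⇒0≤q-p 1≤β) 0≤D) (*-nonNeg (<⇒≤ 0<β) (sq-nonNeg b))

    Energy≡β*Var+excess : Energy∞ (Star k) π f ≡ β * Var π f + excess
    Energy≡β*Var+excess =
      trans Energy≡ (trans (regroup β w M a b) (cong (λ V → β * V + excess) (sym Var≡a-b²)))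
      where
      regroup : ∀ β w M a b → (β - 1ℚ) * w * M + a
                            ≡ β * (a - b * b) + ((β - 1ℚ) * (w * M - a) + β * (b * b))
      regroup = solve 5 (λ β w M a b → (β :- con 1ℚ) :* w :* M :+ a
                                     := β :* (a :- b :* b) :+ ((β :- con 1ℚ) :* (w :* M :- a) :+ β :* (b :* b)))
                        refl

    β+δ≤Ratio∞ : ∀ {δ} (0<Var : 0ℚ < Var π f) → δ * Var π f ≤ excess → β + δ ≤ Ratio∞ (Star k) π f 0<Var
    β+δ≤Ratio∞ {δ} 0<Var δV≤excess = *≤⇒≤÷ 0<Var (begin
      (β + δ) * Var π f              ≡⟨ *-distribʳ-+ (Var π f) β δ ⟩
      β * Var π f + δ * Var π f      ≤⟨ +-monoʳ-≤ (β * Var π f) δV≤excess ⟩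
      β * Var π f + excess           ≡⟨ Energy≡β*Var+excess ⟨
      Energy∞ (Star k) π f           ∎)
      where open ≤-Reasoning

    β≤Ratio∞ : (0<Var : 0ℚ < Var π f) → β ≤ Ratio∞ (Star k) π f 0<Var
    β≤Ratio∞ 0<Var = subst (_≤ Ratio∞ (Star k) π f 0<Var) (+-identityʳ β)
                           (β+δ≤Ratio∞ 0<Var (subst (_≤ excess) (sym (*-zeroˡ (Var π f))) 0≤excess))

    Var≤w*M : Var π f ≤ w * M
    Var≤w*M = ≤-from-gap (+-nonNeg (sq-nonNeg b) 0≤D)
                         (trans (regroup a b (w * M)) (cong (_+ (sq b + D)) (sym Var≡a-b²)))
      where
      regroup : ∀ a b x → x ≡ (a - b * b) + (b * b + (x - a))
      regroup = solve 3 (λ a b x → x := (a :- b :* b) :+ (b :* b :+ (x :- a))) refl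

    j* : Fin (suc k)
    j* = proj₁ M-attained

    m : ℚ
    m = ∣ d j* ∣

    0≤m : 0ℚ ≤ m
    0≤m = 0≤∣p∣ (d j*)

    M≡m² : M ≡ sq m
    M≡m² = trans (proj₂ M-attained) (sym (sq-∣∣ (d j*)))

    ∣d∣≤m : ∀ j → ∣ d j ∣ ≤ m
    ∣d∣≤m j = sq-cancel-≤ (subst (sq (d j) ≤_) (proj₂ M-attained) (sq-d≤M j))

    R : ℚ
    R = sumℚ (λ j → π (suc j) * (m - ∣ d j ∣))

    m*R≤D : m * R ≤ D
    m*R≤D = begin
      m * R                                       ≡⟨ sumℚ-* m (λ j → π (suc j) * (m - ∣ d j ∣)) ⟨
      sumℚ (λ j → m * (π (suc j) * (m - ∣ d j ∣))) ≤⟨ sumℚ-mono-≤ termwise ⟩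
      sumℚ (λ j → π (suc j) * (M - sq (d j)))      ≡⟨ D≡Σ ⟨
      D                                           ∎
      where
      open ≤-Reasoning
      swap : ∀ x y z → x * (y * z) ≡ y * (x * z)
      swap = solve 3 (λ x y z → x :* (y :* z) := y :* (x :* z)) refl
      termwise : ∀ j → m * (π (suc j) * (m - ∣ d j ∣)) ≤ π (suc j) * (M - sq (d j))
      termwise j = begin
        m * (π (suc j) * (m - ∣ d j ∣))  ≡⟨ swap m (π (suc j)) (m - ∣ d j ∣) ⟩
        π (suc j) * (m * (m - ∣ d j ∣))  ≤⟨ *-monoˡ-≤-nonNeg (π (suc j)) {{nonNegative (0≤π-leaf j)}}
                                              (m*[m-y]≤m²-y² (0≤∣p∣ (d j)) (∣d∣≤m j)) ⟩
        π (suc j) * (sq m - sq ∣ d j ∣)  ≡⟨ cong₂ (λ s t → π (suc j) * (s - t)) (sym M≡m²) (sq-∣∣ (d j)) ⟩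
        π (suc j) * (M - sq (d j))       ∎

    side : Fin (suc k) → Bool
    side j = does (0ℚ ≤? d j)

    s : Fin (suc k) → ℚ
    s j = sign (side j)

    T : ℚ
    T = sumℚ (λ j → ρ j * s j)

    w*m*T-b≡Σ : w * m * T - b ≡ sumℚ (λ j → π (suc j) * (m * s j - d j))
    w*m*T-b≡Σ = sym (begin
      sumℚ (λ j → π (suc j) * (m * s j - d j))
        ≡⟨ sumℚ-cong (λ j → distribute w (ρ j) m (s j) (d j)) ⟩
      sumℚ (λ j → w * m * (ρ j * s j) - π (suc j) * d j)
        ≡⟨ sumℚ-- (λ j → w * m * (ρ j * s j)) (λ j → π (suc j) * d j) ⟩
      sumℚ (λ j → w * m * (ρ j * s j)) - b
        ≡⟨ cong (_- b) (sumℚ-* (w * m) (λ j → ρ j * s j)) ⟩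
      w * m * T - b ∎)
      where
      open ≡-Reasoning
      distribute : ∀ w ρ m s d → w * ρ * (m * s - d) ≡ w * m * (ρ * s) - w * ρ * d
      distribute = solve 5 (λ w ρ m s d → w :* ρ :* (m :* s :- d) := w :* m :* (ρ :* s) :- w :* ρ :* d)
                           refl

    ∣w*m*T-b∣≤R : ∣ w * m * T - b ∣ ≤ R
    ∣w*m*T-b∣≤R = begin
      ∣ w * m * T - b ∣                               ≡⟨ cong ∣_∣ w*m*T-b≡Σ ⟩
      ∣ sumℚ (λ j → π (suc j) * (m * s j - d j)) ∣    ≤⟨ ∣sumℚ∣≤sumℚ∣∣ (λ j → π (suc j) * (m * s j - d j)) ⟩
      sumℚ (λ j → ∣ π (suc j) * (m * s j - d j) ∣)    ≡⟨ sumℚ-cong termwise ⟩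
      R                                               ∎
      where
      open ≤-Reasoning
      termwise : ∀ j → ∣ π (suc j) * (m * s j - d j) ∣ ≡ π (suc j) * (m - ∣ d j ∣)
      termwise j = begin-equality
        ∣ π (suc j) * (m * s j - d j) ∣               ≡⟨ ∣p*q∣≡∣p∣*∣q∣ (π (suc j)) (m * s j - d j) ⟩
        ∣ π (suc j) ∣ * ∣ m * s j - d j ∣             ≡⟨ cong₂ (λ x y → x * ∣ m * s j - y ∣)
                                                          (0≤p⇒∣p∣≡p (0≤π-leaf j)) (sym (sign-∣∣ (0ℚ ≤? d j))) ⟩
        π (suc j) * ∣ m * s j - s j * ∣ d j ∣ ∣       ≡⟨ cong (π (suc j) *_) (∣m*s-s*y∣≡m-y (side j) (∣d∣≤m j)) ⟩
        π (suc j) * (m - ∣ d j ∣)                     ∎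

    u≤∣T∣ : ¬ EqualPartition p → u ≤ ∣ T ∣
    u≤∣T∣ ¬balanced = subst (λ t → u ≤ ∣ t ∣) (sym (sumℚ-signed S side p))
                            (1/n≤∣a/n-b/n∣ S (λ balanced → ¬balanced (side , balanced)))

    X : ℚ
    X = w * m * u

    0≤X : 0ℚ ≤ X
    0≤X = *-nonNeg (*-nonNeg 0≤w 0≤m) (<⇒≤ 0<u)

    X≤m : X ≤ m
    X≤m = ≤-from-gap (+-nonNeg (*-nonNeg 0≤m (p≤q⇒0≤q-p w≤1)) (*-nonNeg (*-nonNeg 0≤w 0≤m) (p≤q⇒0≤q-p u≤1)))
                     (regroup m w u)
      where
      regroup : ∀ m w u → m ≡ w * m * u + (m * (1ℚ - w) + w * m * (1ℚ - u))
      regroup = solve 3 (λ m w u → m := w :* m :* u :+ (m :* (con 1ℚ :- w) :+ w :* m :* (con 1ℚ :- u))) refl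

    X≤∣b∣+R : ¬ EqualPartition p → X ≤ ∣ b ∣ + R
    X≤∣b∣+R ¬balanced = begin
      w * m * u                       ≤⟨ *-monoˡ-≤-nonNeg (w * m) {{nonNegative 0≤wm}} (u≤∣T∣ ¬balanced) ⟩
      w * m * ∣ T ∣                   ≡⟨ cong (_* ∣ T ∣) (0≤p⇒∣p∣≡p 0≤wm) ⟨
      ∣ w * m ∣ * ∣ T ∣               ≡⟨ ∣p*q∣≡∣p∣*∣q∣ (w * m) T ⟨
      ∣ w * m * T ∣                   ≡⟨ cong ∣_∣ (regroup (w * m * T) b) ⟩
      ∣ (w * m * T - b) + b ∣         ≤⟨ ∣p+q∣≤∣p∣+∣q∣ (w * m * T - b) b ⟩
      ∣ w * m * T - b ∣ + ∣ b ∣       ≤⟨ +-monoˡ-≤ ∣ b ∣ ∣w*m*T-b∣≤R ⟩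
      R + ∣ b ∣                       ≡⟨ +-comm R ∣ b ∣ ⟩
      ∣ b ∣ + R                       ∎
      where
      open ≤-Reasoning
      0≤wm : 0ℚ ≤ w * m
      0≤wm = *-nonNeg 0≤w 0≤m
      regroup : ∀ x b → x ≡ (x - b) + b
      regroup = solve 2 (λ x b → x := (x :- b) :+ b) refl

    excess-gap : ¬ EqualPartition p → + 1 / 4 * omegaScale k β 1<β p pos * Var π f ≤ excess
    excess-gap ¬balanced = begin
      + 1 / 4 * Ω * Var π f                ≤⟨ *-monoˡ-≤-nonNeg (+ 1 / 4 * Ω) {{nonNegative 0≤¼Ω}} Var≤w*M ⟩
      + 1 / 4 * Ω * (w * M)                ≡⟨ cong₂ (λ Ω M → + 1 / 4 * Ω * (w * M)) omegaScale≡ M≡m² ⟩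
      + 1 / 4 * ((β - 1ℚ) * w * sq u) * (w * sq m) ≡⟨ regroup β w u m ⟩
      + 1 / 4 * ((β - 1ℚ) * sq X)          ≤⟨ quarter-bound {y = ∣ b ∣} 1≤β 0≤X X≤m 0≤D m*R≤D (X≤∣b∣+R ¬balanced) ⟩
      (β - 1ℚ) * D + β * sq ∣ b ∣          ≡⟨ cong (λ t → (β - 1ℚ) * D + β * t) (sq-∣∣ b) ⟩
      excess                               ∎
      where
      open ≤-Reasoning
      Ω : ℚ
      Ω = omegaScale k β 1<β p pos
      0≤¼Ω : 0ℚ ≤ + 1 / 4 * Ω
      0≤¼Ω = *-nonNeg ¼-nonNeg (subst (0ℚ ≤_) (sym omegaScale≡)
                                      (*-nonNeg (*-nonNeg (p≤q⇒0≤q-p 1≤β) 0≤w) (sq-nonNeg u)))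
      regroup : ∀ β w u m → + 1 / 4 * ((β - 1ℚ) * w * (u * u)) * (w * (m * m))
                          ≡ + 1 / 4 * ((β - 1ℚ) * ((w * m * u) * (w * m * u)))
      regroup = solve 4 (λ β w u m → con (+ 1 / 4) :* ((β :- con 1ℚ) :* w :* (u :* u)) :* (w :* (m :* m))
                                   := con (+ 1 / 4) :* ((β :- con 1ℚ) :* ((w :* m :* u) :* (w :* m :* u))))
                        refl

  λ∞≥β : LambdaInf≥ (Star k) π β
  λ∞≥β f = TestFunction.β≤Ratio∞ f

  λ∞-gap : ¬ EqualPartition p → LambdaInf≥ (Star k) π (β + + 1 / 4 * omegaScale k β 1<β p pos)
  λ∞-gap ¬balanced f 0<Var = TestFunction.β+δ≤Ratio∞ f 0<Var (TestFunction.excess-gap f ¬balanced)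

  module SignFunction (A : Fin (suc k) → Bool) (balanced : subsetSum A p ≡ complementSum A p) where

    f : Fin (suc (suc k)) → ℚ
    f zero    = 0ℚ
    f (suc j) = sign (A j)

    open TestFunction f using (d; a; b; M; excess; M-attained; Var≡a-b²; Energy≡β*Var+excess)

    sq-d≡1 : ∀ j → sq (d j) ≡ 1ℚ
    sq-d≡1 j with A j
    ... | true  = refl
    ... | false = refl

    a≡w : a ≡ w
    a≡w = trans (sumℚ-cong (λ j → trans (cong (π (suc j) *_) (sq-d≡1 j)) (*-identityʳ (π (suc j)))))
                Σπ-leaf≡w

    b≡0 : b ≡ 0ℚ
    b≡0 = begin
      sumℚ (λ j → π (suc j) * (sign (A j) - 0ℚ))    ≡⟨ sumℚ-cong (λ j → regroup w (ρ j) (sign (A j))) ⟩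
      sumℚ (λ j → w * (ρ j * sign (A j)))           ≡⟨ sumℚ-* w (λ j → ρ j * sign (A j)) ⟩
      w * sumℚ (λ j → ρ j * sign (A j))             ≡⟨ cong (w *_) (sumℚ-signed S A p) ⟩
      w * (+ subsetSum A p / S - + complementSum A p / S)
        ≡⟨ cong (λ t → w * (+ t / S - + complementSum A p / S)) balanced ⟩
      w * (+ complementSum A p / S - + complementSum A p / S) ≡⟨ cancel w (+ complementSum A p / S) ⟩
      0ℚ                                            ∎
      where
      open ≡-Reasoning
      regroup : ∀ w ρ σ → w * ρ * (σ - 0ℚ) ≡ w * (ρ * σ)
      regroup = solve 3 (λ w ρ σ → w :* ρ :* (σ :- con 0ℚ) := w :* (ρ :* σ)) refl
      cancel : ∀ w x → w * (x - x) ≡ 0ℚ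
      cancel = solve 2 (λ w x → w :* (x :- x) := con 0ℚ) refl

    excess≡0 : excess ≡ 0ℚ
    excess≡0 = begin
      (β - 1ℚ) * (w * M - a) + β * sq b      ≡⟨ cong₂ (λ M a → (β - 1ℚ) * (w * M - a) + β * sq b) M≡1 a≡w ⟩
      (β - 1ℚ) * (w * 1ℚ - w) + β * sq b     ≡⟨ cong (λ b → (β - 1ℚ) * (w * 1ℚ - w) + β * sq b) b≡0 ⟩
      (β - 1ℚ) * (w * 1ℚ - w) + β * sq 0ℚ    ≡⟨ vanish β w ⟩
      0ℚ                                     ∎
      where
      open ≡-Reasoning
      M≡1 : M ≡ 1ℚ
      M≡1 = trans (proj₂ M-attained) (sq-d≡1 (proj₁ M-attained))
      vanish : ∀ β w → (β - 1ℚ) * (w * 1ℚ - w) + β * (0ℚ * 0ℚ) ≡ 0ℚ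
      vanish = solve 2 (λ β w → (β :- con 1ℚ) :* (w :* con 1ℚ :- w) :+ β :* (con 0ℚ :* con 0ℚ) := con 0ℚ) refl

    Var≡w : Var π f ≡ w
    Var≡w = trans Var≡a-b² (trans (cong₂ (λ a b → a - sq b) a≡w b≡0) (minus-zero w))
      where
      minus-zero : ∀ w → w - 0ℚ * 0ℚ ≡ w
      minus-zero = solve 1 (λ w → w :- con 0ℚ :* con 0ℚ := w) refl

    0<Var : 0ℚ < Var π f
    0<Var = subst (0ℚ <_) (sym Var≡w) 0<w

    Energy≡β*Var : Energy∞ (Star k) π f ≡ β * Var π f
    Energy≡β*Var = trans Energy≡β*Var+excess
                         (trans (cong (_+_ (β * Var π f)) excess≡0) (+-identityʳ (β * Var π f)))

    Ratio≡β : Ratio∞ (Star k) π f 0<Var ≡ β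
    Ratio≡β = trans (cong (λ E → (E ÷ Var π f) {{>-nonZero 0<Var}}) Energy≡β*Var) (*÷-cancel 0<Var)

  λ∞≡β-of-partition : EqualPartition p → IsLambdaInf (Star k) π β
  λ∞≡β-of-partition (A , balanced) = λ∞≥β , λ ε 0<ε →
    f , 0<Var , subst (_< β + ε) (sym Ratio≡β) (subst (_< β + ε) (+-identityʳ β) (+-monoʳ-< β 0<ε))
    where open SignFunction A balanced using (f; 0<Var; Ratio≡β)

  0<omegaScale : 0ℚ < omegaScale k β 1<β p pos
  0<omegaScale = subst (0ℚ <_) (sym omegaScale≡) (*-pos (*-pos (p<q⇒0<q-p 1<β) 0<w) (*-pos 0<u 0<u))

  no-approximation-below-gap : ¬ EqualPartition p →
    ¬ Σ (Fin (suc (suc k)) → ℚ) λ f → Σ (0ℚ < Var π f) λ 0<Var →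
        Ratio∞ (Star k) π f 0<Var < β + + 1 / 4 * omegaScale k β 1<β p pos
  no-approximation-below-gap ¬balanced (f , 0<Var , below) =
    <-irrefl refl (<-≤-trans below (λ∞-gap ¬balanced f 0<Var))

  partition-of-λ∞≡β : IsLambdaInf (Star k) π β → EqualPartition p
  partition-of-λ∞≡β (_ , approximable) = decidable-stable (equalPartition? p) λ ¬balanced →
    no-approximation-below-gap ¬balanced (approximable _ (*-pos (positive⁻¹ (+ 1 / 4)) 0<omegaScale))

mainTheorem9 : (β : ℚ) (hβ : 1ℚ < β) →
    ((k : ℕ) (p : Fin (suc k) → ℕ) (pos : ∀ j → 0 <ℕ p j) →
        IsLambdaInf (Star k) (starπ k β hβ p pos) β ⇔ EqualPartition p)
    × Σ ℚ (λ c → 0ℚ < c ×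
        ((k : ℕ) (p : Fin (suc k) → ℕ) (pos : ∀ j → 0 <ℕ p j) →
          ¬ EqualPartition p →
          LambdaInf≥ (Star k) (starπ k β hβ p pos)
            (β + c * omegaScale k β hβ p pos)))
mainTheorem9 β 1<β =
    (λ k p pos → mk⇔ (StarGraph.partition-of-λ∞≡β β 1<β k p pos)
                     (StarGraph.λ∞≡β-of-partition β 1<β k p pos))
  , (+ 1 / 4 , positive⁻¹ _ , λ k p pos → StarGraph.λ∞-gap β 1<β k p pos)
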